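{- Let $G=(V,E)$ be a finite simple graph of class two and let $C\subseteq V$ be a minimum vertex cover of $G$. Then for every nonempty independent set $S\subseteq C$ we have $|N_{V-C}(S)|>2|S|$.
   Context: For $X\subseteq V$, $N(X)$ is the union of neighborhoods of vertices of $X$ and $N_S(X)=N(X)\cap S$. $\beta(G)$ is the size of a minimum vertex cover. Alcuin problem: the vertices of $G$ are items initially on the left bank of a river; a man with a boat of capacity $b$ (a positive integer) must carry them all to the right bank so that no two adjacent vertices are ever left together on a bank. Formally, a feasible schedule for capacity $b$ is a sequence of triples $(L_k,B_k,R_k)$, $k=1,\dots,s$, $s$ odd, such that: each triple is a partition of $V$; $L_k$ and $R_k$ are independent sets; $|B_k|\le b$; $L_1\cup B_1=V$; $B_s\cup R_s=V$; for even $k$, $L_k=L_{k-1}$ and $B_k\cup R_k=B_{k-1}\cup R_{k-1}$; for odd $k\ge 3$, $R_k=R_{k-1}$ and $B_k\cup L_k=B_{k-1}\cup L_{k-1}$. The Alcuin number $c(G)$ is the least positive integer $b$ for which a feasible schedule exists. One always has $\beta(G)\le c(G)\le \beta(G)+1$; $G$ is of class one if $c(G)=\beta(G)$ and of class two if $c(G)=\beta(G)+1$. -}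

module Defs where

open import Data.Nat using (ℕ; zero; suc; _+_; _*_; _≤_; _<_)
open import Data.Bool using (Bool; true; false)
open import Data.Fin using (Fin)
open import Data.Fin.Subset using (Subset; _∈_; _∉_; _∪_; _∩_; ⊤; ⊥; ∣_∣)
open import Data.Fin.Subset.Properties using (_∈?_)
open import Data.Fin.Properties using (any?)
open import Data.Vec using (tabulate)
open import Data.Product using (Σ; _×_; _,_; ∃)
open import Data.Sum using (_⊎_)
open import Relation.Nullary using (¬_)
open import Relation.Nullary.Decidable using (⌊_⌋; _×-dec_)
open import Relation.Binary.PropositionalEquality using (_≡_)
open import Data.Bool.Properties using () renaming (_≟_ to _≟ᵇ_)

record Graph (n : ℕ) : Set where
  field
    adj    : Fin n → Fin n → Bool
    sym    : ∀ u v → adj u v ≡ adj v u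
    irrefl : ∀ v → adj v v ≡ false
open Graph public

module _ {n : ℕ} (G : Graph n) where

  Independent : Subset n → Set
  Independent X = ∀ u v → u ∈ X → v ∈ X → adj G u v ≡ false

  IsVertexCover : Subset n → Set
  IsVertexCover C = ∀ u v → adj G u v ≡ true → u ∈ C ⊎ v ∈ C

  IsMinVertexCover : Subset n → Set
  IsMinVertexCover C = IsVertexCover C × (∀ D → IsVertexCover D → ∣ C ∣ ≤ ∣ D ∣)

  IsVertexCoverNumber : ℕ → Set
  IsVertexCoverNumber k = Σ (Subset n) λ C → IsMinVertexCover C × ∣ C ∣ ≡ k

  N : Subset n → Subset n
  N X = tabulate λ v → ⌊ any? (λ u → (u ∈? X) ×-dec (adj G u v ≟ᵇ true)) ⌋

  N[_] : Subset n → Subset n → Subset n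
  N[ S ] X = N X ∩ S

  IsPartition : Subset n → Subset n → Subset n → Set
  IsPartition L B R =
    (L ∪ B) ∪ R ≡ ⊤ × L ∩ B ≡ ⊥ × L ∩ R ≡ ⊥ × B ∩ R ≡ ⊥

  -- A feasible schedule for capacity b: triples (L k, B k, R k) for
  -- k = 1, …, s with s = 2m+1 odd (values at other indices are irrelevant).
  record Schedule (b : ℕ) : Set where
    field
      m : ℕ
      L B R : ℕ → Subset n
      part   : ∀ k → 1 ≤ k → k ≤ 2 * m + 1 → IsPartition (L k) (B k) (R k)
      indL   : ∀ k → 1 ≤ k → k ≤ 2 * m + 1 → Independent (L k)
      indR   : ∀ k → 1 ≤ k → k ≤ 2 * m + 1 → Independent (R k)
      cap    : ∀ k → 1 ≤ k → k ≤ 2 * m + 1 → ∣ B k ∣ ≤ b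
      start  : L 1 ∪ B 1 ≡ ⊤
      finish : B (2 * m + 1) ∪ R (2 * m + 1) ≡ ⊤
      evenL  : ∀ j → j < m → L (2 * j + 2) ≡ L (2 * j + 1)
      evenBR : ∀ j → j < m → B (2 * j + 2) ∪ R (2 * j + 2) ≡ B (2 * j + 1) ∪ R (2 * j + 1)
      oddR   : ∀ j → j < m → R (2 * j + 3) ≡ R (2 * j + 2)
      oddBL  : ∀ j → j < m → B (2 * j + 3) ∪ L (2 * j + 3) ≡ B (2 * j + 2) ∪ L (2 * j + 2)

  Feasible : ℕ → Set
  Feasible b = Schedule b

  IsAlcuinNumber : ℕ → Set
  IsAlcuinNumber c = 1 ≤ c × Feasible c × (∀ b → 1 ≤ b → b < c → ¬ Feasible b)

  ClassTwo : Set
  ClassTwo = Σ ℕ λ c → Σ ℕ λ k →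
    IsAlcuinNumber c × IsVertexCoverNumber k × c ≡ suc k

-- Write Y = N_{V−C}(S). If |Y| ≤ 2|S|, split Y into Y₁, Y₂ with |Y₁|, |Y₂| ≤ |S|
-- and put Z = V − (C ∪ Y); the following schedule has capacity |C| = β(G),
-- contradicting c(G) = β(G) + 1. The vertices of C − S stay in the boat
-- throughout. First carry C over and leave S on the right bank; carry Y₁ over
-- and bring S back; leave S on the left bank and carry Y₂ over; then ferry the
-- vertices of Z one at a time, and finally fetch S. Besides C − S the boat
-- holds at most |S| vertices at any time. Since C is a cover, S is independent
-- and Z misses N(S), every edge not meeting C − S joins S to Y, and S never
-- shares a bank with Y₁ or Y₂.
module Submission where

open import Data.Bool using (Bool; true; false; _∧_; _∨_; not)
open import Data.Fin using (Fin; zero; suc; toℕ; fromℕ<)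
open import Data.Fin.Properties using (any?; toℕ<n; fromℕ<-toℕ)
open import Data.Fin.Subset
  using (Subset; _∈_; _∉_; _⊆_; _∪_; _∩_; _─_; ∁; ⁅_⁆; ⊤; ⊥; ∣_∣; Nonempty; inside; outside)
open import Data.Fin.Subset.Properties
  using ( _∈?_; ⊆-refl; drop-∷-⊆; out⊆; in⊆in; p⊆q⇒∣p∣≤∣q∣; x∈⁅x⁆; x∈⁅y⁆⇒x≡y; ∣⁅x⁆∣≡1
        ; x∈p∪q⁺; x∈p∩q⁺; x∈p∩q⁻; x∈∁p⇒x∉p; x∉p⇒x∈∁p; x∈p∧x∉q⇒x∈p─q; p─q⊆p)
open import Data.Nat using (ℕ; zero; suc; _+_; _*_; _≤_; _<_; z≤n; s≤s; _<?_)
open import Data.Nat.Properties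
  using ( ≤-refl; ≤-reflexive; ≤-trans; n≤1+n; +-suc; +-comm; *-suc; +-identityʳ; +-monoʳ-≤; ≮⇒≥
        ; module ≤-Reasoning)
open import Data.Product using (Σ; ∃-syntax; _×_; _,_; proj₁; proj₂)
open import Data.Sum using (_⊎_; inj₁; inj₂)
open import Data.Vec using ([]; _∷_; here; tabulate)
open import Data.Vec.Properties
  using (lookup∘tabulate; tabulate-cong; tabulate-∘; []=⇒lookup; lookup⇒[]=)
open import Function using (_∘_)
open import Relation.Binary.PropositionalEquality
  using (_≡_; _≢_; refl; sym; trans; cong; cong₂; subst)
open import Relation.Nullary using (yes; no; contradiction)
open import Relation.Nullary.Decidable using (isYes≗does; dec-true)

open import Defs renaming (sym to adj-sym)

∣p∪q∣≤∣p∣+∣q∣ : ∀ {n} (p q : Subset n) → ∣ p ∪ q ∣ ≤ ∣ p ∣ + ∣ q ∣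
∣p∪q∣≤∣p∣+∣q∣ []            []           = z≤n
∣p∪q∣≤∣p∣+∣q∣ (outside ∷ p) (outside ∷ q) = ∣p∪q∣≤∣p∣+∣q∣ p q
∣p∪q∣≤∣p∣+∣q∣ (outside ∷ p) (inside ∷ q)  =
  ≤-trans (s≤s (∣p∪q∣≤∣p∣+∣q∣ p q)) (≤-reflexive (sym (+-suc ∣ p ∣ ∣ q ∣)))
∣p∪q∣≤∣p∣+∣q∣ (inside ∷ p)  (outside ∷ q) = s≤s (∣p∪q∣≤∣p∣+∣q∣ p q)
∣p∪q∣≤∣p∣+∣q∣ (inside ∷ p)  (inside ∷ q)  =
  s≤s (≤-trans (∣p∪q∣≤∣p∣+∣q∣ p q) (+-monoʳ-≤ ∣ p ∣ (n≤1+n ∣ q ∣)))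

∣p─q∣+∣q∣≡∣p∣ : ∀ {n} {p q : Subset n} → q ⊆ p → ∣ p ─ q ∣ + ∣ q ∣ ≡ ∣ p ∣
∣p─q∣+∣q∣≡∣p∣ {p = []}          {[]}          _   = refl
∣p─q∣+∣q∣≡∣p∣ {p = outside ∷ p} {outside ∷ q} q⊆p = ∣p─q∣+∣q∣≡∣p∣ (drop-∷-⊆ q⊆p)
∣p─q∣+∣q∣≡∣p∣ {p = inside ∷ p}  {outside ∷ q} q⊆p = cong suc (∣p─q∣+∣q∣≡∣p∣ (drop-∷-⊆ q⊆p))
∣p─q∣+∣q∣≡∣p∣ {p = inside ∷ p}  {inside ∷ q}  q⊆p =
  trans (+-suc _ _) (cong suc (∣p─q∣+∣q∣≡∣p∣ (drop-∷-⊆ q⊆p)))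
∣p─q∣+∣q∣≡∣p∣ {p = outside ∷ p} {inside ∷ q}  q⊆p = contradiction (q⊆p here) λ ()

∣p∣≤∣q∣-exchange : ∀ {n} {p q r s : Subset n} →
  r ⊆ q → ∣ s ∣ ≤ ∣ r ∣ → p ⊆ (q ─ r) ∪ s → ∣ p ∣ ≤ ∣ q ∣
∣p∣≤∣q∣-exchange {p = p} {q} {r} {s} r⊆q ∣s∣≤∣r∣ p⊆ = begin
  ∣ p ∣              ≤⟨ p⊆q⇒∣p∣≤∣q∣ p⊆ ⟩
  ∣ (q ─ r) ∪ s ∣    ≤⟨ ∣p∪q∣≤∣p∣+∣q∣ (q ─ r) s ⟩
  ∣ q ─ r ∣ + ∣ s ∣  ≤⟨ +-monoʳ-≤ ∣ q ─ r ∣ ∣s∣≤∣r∣ ⟩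
  ∣ q ─ r ∣ + ∣ r ∣  ≡⟨ ∣p─q∣+∣q∣≡∣p∣ r⊆q ⟩
  ∣ q ∣              ∎
  where open ≤-Reasoning

∣p∣≤a+b⇒split : ∀ {n} (p : Subset n) a {b} → ∣ p ∣ ≤ a + b →
  ∃[ q ] q ⊆ p × ∣ q ∣ ≤ a × ∣ p ─ q ∣ ≤ b
∣p∣≤a+b⇒split []            a                _       = [] , ⊆-refl , z≤n , z≤n
∣p∣≤a+b⇒split (outside ∷ p) a                h       with ∣p∣≤a+b⇒split p a h
... | q , q⊆p , ∣q∣≤a , ∣p─q∣≤b = outside ∷ q , out⊆ q⊆p , ∣q∣≤a , ∣p─q∣≤b
∣p∣≤a+b⇒split (inside ∷ p)  (suc a)          (s≤s h) with ∣p∣≤a+b⇒split p a h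
... | q , q⊆p , ∣q∣≤a , ∣p─q∣≤b = inside ∷ q , in⊆in q⊆p , s≤s ∣q∣≤a , ∣p─q∣≤b
∣p∣≤a+b⇒split (inside ∷ p)  zero    {suc b}  (s≤s h) with ∣p∣≤a+b⇒split p zero h
... | q , q⊆p , ∣q∣≤a , ∣p─q∣≤b = outside ∷ q , out⊆ q⊆p , ∣q∣≤a , s≤s ∣p─q∣≤b
∣p∣≤a+b⇒split (inside ∷ p)  zero    {zero}   ()

nonempty⇒1≤∣p∣ : ∀ {n} {p : Subset n} → Nonempty p → 1 ≤ ∣ p ∣
nonempty⇒1≤∣p∣ {p = p} (x , x∈p) =
  subst (_≤ ∣ p ∣) (∣⁅x⁆∣≡1 x) (p⊆q⇒∣p∣≤∣q∣ λ y∈⁅x⁆ → subst (_∈ p) (sym (x∈⁅y⁆⇒x≡y x y∈⁅x⁆)) x∈p)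

∈⁅fromℕ<⁆ : ∀ {n} {i : Fin n} {j} (j<n : j < n) → toℕ i ≡ j → i ∈ ⁅ fromℕ< j<n ⁆
∈⁅fromℕ<⁆ {i = i} j<n refl = subst (λ k → i ∈ ⁅ k ⁆) (sym (fromℕ<-toℕ i j<n)) (x∈⁅x⁆ i)

∈-tabulate⁺ : ∀ {n} {f : Fin n → Bool} {i} → f i ≡ true → i ∈ tabulate f
∈-tabulate⁺ {f = f} {i} fi = lookup⇒[]= i (tabulate f) (trans (lookup∘tabulate f i) fi)

∈-tabulate⁻ : ∀ {n} {f : Fin n → Bool} {i} → i ∈ tabulate f → f i ≡ true
∈-tabulate⁻ {f = f} {i} i∈ = trans (sym (lookup∘tabulate f i)) ([]=⇒lookup i∈)

tabulate-∪ : ∀ {n} (f g : Fin n → Bool) → tabulate f ∪ tabulate g ≡ tabulate (λ i → f i ∨ g i)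
tabulate-∪ {zero}  f g = refl
tabulate-∪ {suc n} f g = cong ((f zero ∨ g zero) ∷_) (tabulate-∪ (f ∘ suc) (g ∘ suc))

tabulate-∩ : ∀ {n} (f g : Fin n → Bool) → tabulate f ∩ tabulate g ≡ tabulate (λ i → f i ∧ g i)
tabulate-∩ {zero}  f g = refl
tabulate-∩ {suc n} f g = cong ((f zero ∧ g zero) ∷_) (tabulate-∩ (f ∘ suc) (g ∘ suc))

tabulate-⊤ : ∀ {n} {f : Fin n → Bool} → (∀ i → f i ≡ true) → tabulate f ≡ ⊤
tabulate-⊤ {zero}  _ = refl
tabulate-⊤ {suc n} h = cong₂ _∷_ (h zero) (tabulate-⊤ (h ∘ suc))

tabulate-⊥ : ∀ {n} {f : Fin n → Bool} → (∀ i → f i ≡ false) → tabulate f ≡ ⊥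
tabulate-⊥ {zero}  _ = refl
tabulate-⊥ {suc n} h = cong₂ _∷_ (h zero) (tabulate-⊥ (h ∘ suc))

data Place : Set where
  left boat right : Place

_==_ : Place → Place → Bool
left  == left  = true
boat  == boat  = true
right == right = true
_     == _     = false

==-sound : ∀ {x y} → (x == y) ≡ true → x ≡ y
==-sound {left}  {left}  _  = refl
==-sound {left}  {boat}  ()
==-sound {left}  {right} ()
==-sound {boat}  {left}  ()
==-sound {boat}  {boat}  _  = refl
==-sound {boat}  {right} ()
==-sound {right} {left}  ()
==-sound {right} {boat}  ()
==-sound {right} {right} _  = refl

==-false : ∀ {x y} → x ≢ y → (x == y) ≡ false
==-false {x} {y} x≢y with x == y in eq
... | true  = contradiction (==-sound eq) x≢y
... | false = refl

bank : ∀ {n} → Place → (Fin n → Place) → Subset n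
bank s σ = tabulate (λ i → σ i == s)

∈-bank : ∀ {n s} {σ : Fin n → Place} {i} → i ∈ bank s σ → σ i ≡ s
∈-bank i∈ = ==-sound (∈-tabulate⁻ i∈)

bank-∪-⊤ : ∀ {n} s s' {σ : Fin n → Place} → (∀ i → (σ i == s) ∨ (σ i == s') ≡ true) →
  bank s σ ∪ bank s' σ ≡ ⊤
bank-∪-⊤ s s' h = trans (tabulate-∪ _ _) (tabulate-⊤ h)

bank-∩-⊥ : ∀ {n} s s' (σ : Fin n → Place) → (∀ x → (x == s) ∧ (x == s') ≡ false) →
  bank s σ ∩ bank s' σ ≡ ⊥
bank-∩-⊥ s s' σ h = trans (tabulate-∩ _ _) (tabulate-⊥ (h ∘ σ))

bank-∪-∁ : ∀ {n} s s' s'' (σ : Fin n → Place) → (∀ x → (x == s) ∨ (x == s') ≡ not (x == s'')) →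
  bank s σ ∪ bank s' σ ≡ ∁ (bank s'' σ)
bank-∪-∁ s s' s'' σ h = trans (tabulate-∪ _ _) (trans (tabulate-cong (h ∘ σ)) (tabulate-∘ not _))

boat∪right≡∁left : ∀ {n} (σ : Fin n → Place) → bank boat σ ∪ bank right σ ≡ ∁ (bank left σ)
boat∪right≡∁left σ = bank-∪-∁ boat right left σ λ { left → refl ; boat → refl ; right → refl }

boat∪left≡∁right : ∀ {n} (σ : Fin n → Place) → bank boat σ ∪ bank left σ ≡ ∁ (bank right σ)
boat∪left≡∁right σ = bank-∪-∁ boat left right σ λ { left → refl ; boat → refl ; right → refl }

-- timeline f g takes the value f j at time 2j+1 and g j at time 2j+2 (time 0 is unused).
timeline : ∀ {A : Set} → (ℕ → A) → (ℕ → A) → ℕ → A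
timeline f g zero                = f zero
timeline f g (suc zero)          = f zero
timeline f g (suc (suc zero))    = g zero
timeline f g (suc (suc (suc k))) = timeline (f ∘ suc) (g ∘ suc) (suc k)

timeline-all : ∀ {A : Set} (P : A → Set) {f g : ℕ → A} →
  (∀ j → P (f j)) → (∀ j → P (g j)) → ∀ k → P (timeline f g k)
timeline-all P pf pg zero                = pf zero
timeline-all P pf pg (suc zero)          = pf zero
timeline-all P pf pg (suc (suc zero))    = pg zero
timeline-all P pf pg (suc (suc (suc k))) = timeline-all P (pf ∘ suc) (pg ∘ suc) (suc k)

timeline-1+2j : ∀ {A : Set} (f g : ℕ → A) j → timeline f g (suc (2 * j)) ≡ f j
timeline-1+2j f g zero    = refl
timeline-1+2j f g (suc j) =
  trans (cong (λ k → timeline f g (suc k)) (*-suc 2 j)) (timeline-1+2j (f ∘ suc) (g ∘ suc) j)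

timeline-2+2j : ∀ {A : Set} (f g : ℕ → A) j → timeline f g (suc (suc (2 * j))) ≡ g j
timeline-2+2j f g zero    = refl
timeline-2+2j f g (suc j) =
  trans (cong (λ k → timeline f g (suc (suc k))) (*-suc 2 j)) (timeline-2+2j (f ∘ suc) (g ∘ suc) j)

timeline-2j+1 : ∀ {A : Set} (f g : ℕ → A) j → timeline f g (2 * j + 1) ≡ f j
timeline-2j+1 f g j = trans (cong (timeline f g) (+-comm (2 * j) 1)) (timeline-1+2j f g j)

timeline-2j+2 : ∀ {A : Set} (f g : ℕ → A) j → timeline f g (2 * j + 2) ≡ g j
timeline-2j+2 f g j = trans (cong (timeline f g) (+-comm (2 * j) 2)) (timeline-2+2j f g j)

timeline-2j+3 : ∀ {A : Set} (f g : ℕ → A) j → timeline f g (2 * j + 3) ≡ f (suc j)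
timeline-2j+3 f g j =
  trans (cong (timeline f g) (trans (+-comm (2 * j) 3) (cong suc (sym (*-suc 2 j)))))
        (timeline-1+2j f g (suc j))

module _ {n : ℕ} (G : Graph n) where

  Safe : (Fin n → Place) → Set
  Safe σ = ∀ {u v} → adj G u v ≡ true → σ u ≡ σ v → σ u ≡ boat

  Admissible : ℕ → (Fin n → Place) → Set
  Admissible b σ = Safe σ × ∣ bank boat σ ∣ ≤ b

  -- outward j and inward j place the vertices at times 2j+1 and 2j+2.
  record TripPlan (b : ℕ) : Set where
    field
      m                   : ℕ
      outward inward      : ℕ → Fin n → Place
      outward-admissible  : ∀ j → Admissible b (outward j)
      inward-admissible   : ∀ j → Admissible b (inward j)
      start               : ∀ i → outward 0 i ≢ right
      finish              : ∀ i → outward m i ≢ left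
      unload              : ∀ j → j < m → bank left (inward j) ≡ bank left (outward j)
      load                : ∀ j → j < m → bank right (outward (suc j)) ≡ bank right (inward j)

  bank-partition : ∀ σ → IsPartition G (bank left σ) (bank boat σ) (bank right σ)
  bank-partition σ =
    trans (cong (_∪ bank right σ) (tabulate-∪ _ _))
          (trans (tabulate-∪ _ _) (tabulate-⊤ (exhaustive ∘ σ))) ,
    bank-∩-⊥ left boat  σ (λ { left → refl ; boat → refl ; right → refl }) ,
    bank-∩-⊥ left right σ (λ { left → refl ; boat → refl ; right → refl }) ,
    bank-∩-⊥ boat right σ (λ { left → refl ; boat → refl ; right → refl })
    where
    exhaustive : ∀ x → ((x == left) ∨ (x == boat)) ∨ (x == right) ≡ true
    exhaustive left  = refl
    exhaustive boat  = refl
    exhaustive right = refl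

  bank-independent : ∀ {σ s} → Safe σ → s ≢ boat → Independent G (bank s σ)
  bank-independent safe s≢boat u v u∈ v∈ with adj G u v in e
  ... | false = refl
  ... | true  = contradiction (trans (sym σu≡s) (safe e (trans σu≡s (sym (∈-bank v∈))))) s≢boat
    where σu≡s = ∈-bank u∈

  adjacent⇒∈N : ∀ {X u v} → u ∈ X → adj G u v ≡ true → v ∈ N G X
  adjacent⇒∈N {u = u} u∈X e =
    ∈-tabulate⁺ (trans (isYes≗does (any? _)) (dec-true (any? _) (u , u∈X , e)))

  tripPlan⇒feasible : ∀ {b} → TripPlan b → Feasible G b
  tripPlan⇒feasible {b} plan = record
    { m      = m
    ; L      = λ k → bank left (at k)
    ; B      = λ k → bank boat (at k)
    ; R      = λ k → bank right (at k)
    ; part   = λ k _ _ → bank-partition (at k)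
    ; indL   = λ k _ _ → bank-independent (proj₁ (admissible k)) λ ()
    ; indR   = λ k _ _ → bank-independent (proj₁ (admissible k)) λ ()
    ; cap    = λ k _ _ → proj₂ (admissible k)
    ; start  = bank-∪-⊤ left boat (not-right ∘ start)
    ; finish = subst (λ σ → bank boat σ ∪ bank right σ ≡ ⊤) (sym (timeline-2j+1 outward inward m))
                     (bank-∪-⊤ boat right (not-left ∘ finish))
    ; evenL  = evenL
    ; evenBR = λ j j<m → trans (boat∪right≡∁left _)
                         (trans (cong ∁ (evenL j j<m)) (sym (boat∪right≡∁left _)))
    ; oddR   = oddR
    ; oddBL  = λ j j<m → trans (boat∪left≡∁right _)
                         (trans (cong ∁ (oddR j j<m)) (sym (boat∪left≡∁right _)))
    }
    where
    open TripPlan plan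

    at : ℕ → Fin n → Place
    at = timeline outward inward

    admissible : ∀ k → Admissible b (at k)
    admissible = timeline-all (Admissible b) outward-admissible inward-admissible

    not-right : ∀ {x} → x ≢ right → (x == left) ∨ (x == boat) ≡ true
    not-right {left}  _ = refl
    not-right {boat}  _ = refl
    not-right {right} h = contradiction refl h

    not-left : ∀ {x} → x ≢ left → (x == boat) ∨ (x == right) ≡ true
    not-left {left}  h = contradiction refl h
    not-left {boat}  _ = refl
    not-left {right} _ = refl

    evenL : ∀ j → j < m → bank left (at (2 * j + 2)) ≡ bank left (at (2 * j + 1))
    evenL j j<m = trans (cong (bank left) (timeline-2j+2 outward inward j))
                  (trans (unload j j<m) (cong (bank left) (sym (timeline-2j+1 outward inward j))))

    oddR : ∀ j → j < m → bank right (at (2 * j + 3)) ≡ bank right (at (2 * j + 2))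
    oddR j j<m = trans (cong (bank right) (timeline-2j+3 outward inward j))
                 (trans (load j j<m) (cong (bank right) (sym (timeline-2j+2 outward inward j))))

-- While the Z-vertex with index j crosses, the Z-vertex with index t is at ferrying j t,
-- and after that crossing at delivered j t; meanwhile S is at waiting j n, on the left
-- bank until the final crossing j = n.
ferrying : ℕ → ℕ → Place
ferrying zero    zero    = boat
ferrying zero    (suc _) = left
ferrying (suc _) zero    = right
ferrying (suc j) (suc t) = ferrying j t

delivered : ℕ → ℕ → Place
delivered zero    zero    = right
delivered zero    (suc _) = left
delivered (suc _) zero    = right
delivered (suc j) (suc t) = delivered j t

waiting : ℕ → ℕ → Place
waiting zero    zero    = boat
waiting zero    (suc _) = left
waiting (suc _) zero    = boat
waiting (suc j) (suc k) = waiting j k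

delivered-left : ∀ j t → (delivered j t == left) ≡ (ferrying j t == left)
delivered-left zero    zero    = refl
delivered-left zero    (suc t) = refl
delivered-left (suc j) zero    = refl
delivered-left (suc j) (suc t) = delivered-left j t

ferrying-suc-right : ∀ j t → (ferrying (suc j) t == right) ≡ (delivered j t == right)
ferrying-suc-right zero    zero          = refl
ferrying-suc-right zero    (suc zero)    = refl
ferrying-suc-right zero    (suc (suc t)) = refl
ferrying-suc-right (suc j) zero          = refl
ferrying-suc-right (suc j) (suc t)       = ferrying-suc-right j t

ferrying-zero-right : ∀ t → (ferrying zero t == right) ≡ false
ferrying-zero-right zero    = refl
ferrying-zero-right (suc t) = refl

ferrying-boat : ∀ j t → ferrying j t ≡ boat → t ≡ j
ferrying-boat zero    zero    _  = refl
ferrying-boat zero    (suc t) ()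
ferrying-boat (suc j) zero    ()
ferrying-boat (suc j) (suc t) eq = cong suc (ferrying-boat j t eq)

ferrying-< : ∀ {j t} → t < j → ferrying j t ≡ right
ferrying-< {suc j} {zero}  _         = refl
ferrying-< {suc j} {suc t} (s≤s t<j) = ferrying-< t<j

delivered≢boat : ∀ j t → delivered j t ≢ boat
delivered≢boat zero    zero    ()
delivered≢boat zero    (suc t) ()
delivered≢boat (suc j) zero    ()
delivered≢boat (suc j) (suc t) = delivered≢boat j t

waiting-< : ∀ {j k} → j < k → waiting j k ≡ left
waiting-< {zero}  {suc k} _         = refl
waiting-< {suc j} {suc k} (s≤s j<k) = waiting-< j<k

waiting-self : ∀ k → waiting k k ≡ boat
waiting-self zero    = refl
waiting-self (suc k) = waiting-self k

waiting≢right : ∀ j k → waiting j k ≢ right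
waiting≢right zero    zero    ()
waiting≢right zero    (suc k) ()
waiting≢right (suc j) zero    ()
waiting≢right (suc j) (suc k) = waiting≢right j k

-- The roles of a vertex: in S, in C − S, in Y₁, in Y₂ = Y − Y₁, in Z = V − (C ∪ Y).
data Role : Set where
  inS inC inY₁ inY₂ inZ : Role

record Stage : Set where
  constructor stage
  field
    atS atY₁ atY₂ : Place
    atZ           : ℕ → Place
open Stage

place : Stage → Role → ℕ → Place
place σ inS  _ = atS σ
place σ inC  _ = boat
place σ inY₁ _ = atY₁ σ
place σ inY₂ _ = atY₂ σ
place σ inZ  t = atZ σ t

Apart : Place → Place → Set
Apart x y = x ≡ y → x ≡ boat

≢⇒apart : ∀ {x y} → x ≢ y → Apart x y
≢⇒apart x≢y x≡y = contradiction x≡y x≢y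

module FerryPlan {n : ℕ} (G : Graph n) {C S Y₁ : Subset n}
  (cover : IsVertexCover G C) (S-independent : Independent G S) (S⊆C : S ⊆ C)
  (S-nonempty : Nonempty S) (Y₁⊆Y : Y₁ ⊆ N[_] G (∁ C) S) (∣Y₁∣≤∣S∣ : ∣ Y₁ ∣ ≤ ∣ S ∣)
  (∣Y─Y₁∣≤∣S∣ : ∣ N[_] G (∁ C) S ─ Y₁ ∣ ≤ ∣ S ∣) where

  Y : Subset n
  Y = N[_] G (∁ C) S

  ∈Y⇒∉C : ∀ {i} → i ∈ Y → i ∉ C
  ∈Y⇒∉C i∈Y = x∈∁p⇒x∉p (proj₂ (x∈p∩q⁻ _ _ i∈Y))

  S-neighbour∈Y : ∀ {u v} → u ∈ S → adj G u v ≡ true → v ∉ C → v ∈ Y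
  S-neighbour∈Y u∈S e v∉C = x∈p∩q⁺ (adjacent⇒∈N G u∈S e , x∉p⇒x∈∁p v∉C)

  HasRole : Fin n → Role → Set
  HasRole i inS  = i ∈ S
  HasRole i inC  = i ∈ C × i ∉ S
  HasRole i inY₁ = i ∈ Y₁
  HasRole i inY₂ = i ∈ Y ─ Y₁
  HasRole i inZ  = i ∉ C × i ∉ Y

  classify : ∀ i → Σ Role (HasRole i)
  classify i with i ∈? S | i ∈? C | i ∈? Y₁ | i ∈? Y
  ... | yes i∈S | _       | _        | _       = inS , i∈S
  ... | no i∉S  | yes i∈C | _        | _       = inC , i∈C , i∉S
  ... | no _    | no _    | yes i∈Y₁ | _       = inY₁ , i∈Y₁
  ... | no _    | no _    | no i∉Y₁  | yes i∈Y = inY₂ , x∈p∧x∉q⇒x∈p─q i∈Y i∉Y₁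
  ... | no _    | no i∉C  | no _     | no i∉Y  = inZ , i∉C , i∉Y

  role : Fin n → Role
  role i = proj₁ (classify i)

  role-spec : ∀ i → HasRole i (role i)
  role-spec i = proj₂ (classify i)

  ∈C⇒role : ∀ {i} r → HasRole i r → i ∈ C → r ≡ inS ⊎ r ≡ inC
  ∈C⇒role inS  _          _   = inj₁ refl
  ∈C⇒role inC  _          _   = inj₂ refl
  ∈C⇒role inY₁ i∈Y₁       i∈C = contradiction i∈C (∈Y⇒∉C (Y₁⊆Y i∈Y₁))
  ∈C⇒role inY₂ i∈Y₂       i∈C = contradiction i∈C (∈Y⇒∉C (p─q⊆p Y Y₁ i∈Y₂))
  ∈C⇒role inZ  (i∉C , _)  i∈C = contradiction i∈C i∉C

  S-neighbour-role : ∀ {u v} r → u ∈ S → adj G u v ≡ true → HasRole v r →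
    r ≡ inC ⊎ r ≡ inY₁ ⊎ r ≡ inY₂
  S-neighbour-role inS  u∈S e v∈S         =
    contradiction (trans (sym e) (S-independent _ _ u∈S v∈S)) λ ()
  S-neighbour-role inC  _   _ _           = inj₁ refl
  S-neighbour-role inY₁ _   _ _           = inj₂ (inj₁ refl)
  S-neighbour-role inY₂ _   _ _           = inj₂ (inj₂ refl)
  S-neighbour-role inZ  u∈S e (v∉C , v∉Y) = contradiction (S-neighbour∈Y u∈S e v∉C) v∉Y

  config : Stage → Fin n → Place
  config σ i = place σ (role i) (toℕ i)

  module _ (σ : Stage) (S-Y₁ : Apart (atS σ) (atY₁ σ)) (S-Y₂ : Apart (atS σ) (atY₂ σ)) where

    edge-from-C : ∀ {u v} ru rv → HasRole u ru → HasRole v rv → adj G u v ≡ true → u ∈ C →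
      place σ ru (toℕ u) ≡ place σ rv (toℕ v) → place σ ru (toℕ u) ≡ boat
    edge-from-C ru rv hu hv e u∈C same with ∈C⇒role ru hu u∈C
    ... | inj₂ refl = refl
    ... | inj₁ refl with S-neighbour-role rv hu e hv
    ...   | inj₁ refl        = same
    ...   | inj₂ (inj₁ refl) = S-Y₁ same
    ...   | inj₂ (inj₂ refl) = S-Y₂ same

    config-safe : Safe G (config σ)
    config-safe {u} {v} e same with cover u v e
    ... | inj₁ u∈C = edge-from-C (role u) (role v) (role-spec u) (role-spec v) e u∈C same
    ... | inj₂ v∈C = trans same (edge-from-C (role v) (role u) (role-spec v) (role-spec u)
                                             (trans (adj-sym G v u) e) v∈C (sym same))

  config-capacity : ∀ σ (T : Subset n) → ∣ T ∣ ≤ ∣ S ∣ →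
    (atS σ ≡ boat → S ⊆ T) → (atY₁ σ ≡ boat → Y₁ ⊆ T) → (atY₂ σ ≡ boat → Y ─ Y₁ ⊆ T) →
    (∀ i → atZ σ (toℕ i) ≡ boat → i ∈ T) → ∣ bank boat (config σ) ∣ ≤ ∣ C ∣
  config-capacity σ T ∣T∣≤∣S∣ hS hY₁ hY₂ hZ =
    ∣p∣≤∣q∣-exchange S⊆C ∣T∣≤∣S∣ λ {i} i∈ →
      x∈p∪q⁺ (aboard i (role i) (role-spec i) (∈-bank {σ = config σ} i∈))
    where
    aboard : ∀ i r → HasRole i r → place σ r (toℕ i) ≡ boat → i ∈ C ─ S ⊎ i ∈ T
    aboard i inS  i∈S         e = inj₂ (hS e i∈S)
    aboard i inC  (i∈C , i∉S) _ = inj₁ (x∈p∧x∉q⇒x∈p─q i∈C i∉S)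
    aboard i inY₁ i∈Y₁        e = inj₂ (hY₁ e i∈Y₁)
    aboard i inY₂ i∈Y₂        e = inj₂ (hY₂ e i∈Y₂)
    aboard i inZ  _           e = inj₂ (hZ i e)

  config-avoids : ∀ σ s → boat ≢ s → atS σ ≢ s → atY₁ σ ≢ s → atY₂ σ ≢ s →
    (∀ t → t < n → atZ σ t ≢ s) → ∀ i → config σ i ≢ s
  config-avoids σ s hC hS hY₁ hY₂ hZ i = avoids (role i)
    where
    avoids : ∀ r → place σ r (toℕ i) ≢ s
    avoids inS  = hS
    avoids inC  = hC
    avoids inY₁ = hY₁
    avoids inY₂ = hY₂
    avoids inZ  = hZ (toℕ i) (toℕ<n i)

  same-bank : ∀ s σ τ → (atS σ == s) ≡ (atS τ == s) → (atY₁ σ == s) ≡ (atY₁ τ == s) →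
    (atY₂ σ == s) ≡ (atY₂ τ == s) → (∀ t → (atZ σ t == s) ≡ (atZ τ t == s)) →
    bank s (config σ) ≡ bank s (config τ)
  same-bank s σ τ hS hY₁ hY₂ hZ = tabulate-cong λ i → same (role i) (toℕ i)
    where
    same : ∀ r t → (place σ r t == s) ≡ (place τ r t == s)
    same inS  _ = hS
    same inC  _ = refl
    same inY₁ _ = hY₁
    same inY₂ _ = hY₂
    same inZ  t = hZ t

  outward : ℕ → Stage
  outward 0                   = stage boat  left  left  λ _ → left
  outward 1                   = stage right boat  left  λ _ → left
  outward 2                   = stage left  right boat  λ _ → left
  outward (suc (suc (suc j))) = stage (waiting j n) right right (ferrying j)

  inward : ℕ → Stage
  inward 0                   = stage right left  left  λ _ → left
  inward 1                   = stage boat  right left  λ _ → left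
  inward 2                   = stage left  right right λ _ → left
  inward (suc (suc (suc j))) = stage left  right right (delivered j)

  1≤∣S∣ : 1 ≤ ∣ S ∣
  1≤∣S∣ = nonempty⇒1≤∣p∣ S-nonempty

  ferry-capacity : ∀ j → ∣ bank boat (config (outward (3 + j))) ∣ ≤ ∣ C ∣
  ferry-capacity j with j <? n
  ... | yes j<n = config-capacity _ ⁅ fromℕ< j<n ⁆
        (subst (_≤ ∣ S ∣) (sym (∣⁅x⁆∣≡1 (fromℕ< j<n))) 1≤∣S∣)
        (λ e → contradiction (trans (sym (waiting-< j<n)) e) λ ()) (λ ()) (λ ())
        (λ i e → ∈⁅fromℕ<⁆ j<n (ferrying-boat j (toℕ i) e))
  ... | no j≮n  = config-capacity _ S ≤-refl (λ _ → ⊆-refl) (λ ()) (λ ())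
        (λ i e → contradiction (subst (_< n) (ferrying-boat j (toℕ i) e) (toℕ<n i)) j≮n)

  outward-admissible : ∀ j → Admissible G ∣ C ∣ (config (outward j))
  outward-admissible 0 =
    config-safe _ (λ _ → refl) (λ _ → refl) ,
    config-capacity _ S ≤-refl (λ _ → ⊆-refl) (λ ()) (λ ()) (λ _ ())
  outward-admissible 1 =
    config-safe _ (λ ()) (λ ()) ,
    config-capacity _ Y₁ ∣Y₁∣≤∣S∣ (λ ()) (λ _ → ⊆-refl) (λ ()) (λ _ ())
  outward-admissible 2 =
    config-safe _ (λ ()) (λ ()) ,
    config-capacity _ (Y ─ Y₁) ∣Y─Y₁∣≤∣S∣ (λ ()) (λ ()) (λ _ → ⊆-refl) (λ _ ())
  outward-admissible (suc (suc (suc j))) =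
    config-safe _ (≢⇒apart (waiting≢right j n)) (≢⇒apart (waiting≢right j n)) ,
    ferry-capacity j

  inward-admissible : ∀ j → Admissible G ∣ C ∣ (config (inward j))
  inward-admissible 0 =
    config-safe _ (λ ()) (λ ()) ,
    config-capacity _ S ≤-refl (λ ()) (λ ()) (λ ()) (λ _ ())
  inward-admissible 1 =
    config-safe _ (λ _ → refl) (λ _ → refl) ,
    config-capacity _ S ≤-refl (λ _ → ⊆-refl) (λ ()) (λ ()) (λ _ ())
  inward-admissible 2 =
    config-safe _ (λ ()) (λ ()) ,
    config-capacity _ S ≤-refl (λ ()) (λ ()) (λ ()) (λ _ ())
  inward-admissible (suc (suc (suc j))) =
    config-safe _ (λ ()) (λ ()) ,
    config-capacity _ S ≤-refl (λ ()) (λ ()) (λ ())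
      (λ i e → contradiction e (delivered≢boat j (toℕ i)))

  unload : ∀ j → j < 3 + n → bank left (config (inward j)) ≡ bank left (config (outward j))
  unload 0 _ = same-bank left (inward 0) (outward 0) refl refl refl λ _ → refl
  unload 1 _ = same-bank left (inward 1) (outward 1) refl refl refl λ _ → refl
  unload 2 _ = same-bank left (inward 2) (outward 2) refl refl refl λ _ → refl
  unload (suc (suc (suc j))) (s≤s (s≤s (s≤s j<n))) =
    same-bank left (inward (3 + j)) (outward (3 + j))
      (cong (_== left) (sym (waiting-< j<n))) refl refl (delivered-left j)

  load : ∀ j → bank right (config (outward (suc j))) ≡ bank right (config (inward j))
  load 0 = same-bank right (outward 1) (inward 0) refl refl refl λ _ → refl
  load 1 = same-bank right (outward 2) (inward 1) refl refl refl λ _ → refl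
  load 2 = same-bank right (outward 3) (inward 2)
    (==-false (waiting≢right 0 n)) refl refl ferrying-zero-right
  load (suc (suc (suc j))) = same-bank right (outward (4 + j)) (inward (3 + j))
    (==-false (waiting≢right (suc j) n)) refl refl (ferrying-suc-right j)

  plan : TripPlan G ∣ C ∣
  plan = record
    { m                  = 3 + n
    ; outward            = config ∘ outward
    ; inward             = config ∘ inward
    ; outward-admissible = outward-admissible
    ; inward-admissible  = inward-admissible
    ; start              = config-avoids (outward 0) right (λ ()) (λ ()) (λ ()) (λ ()) λ _ _ ()
    ; finish             = config-avoids (outward (3 + n)) left (λ ())
                             (λ e → contradiction (trans (sym (waiting-self n)) e) λ ())
                             (λ ()) (λ ())
                             (λ t t<n e → contradiction (trans (sym (ferrying-< t<n)) e) λ ())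
    ; unload             = unload
    ; load               = λ j _ → load j
    }

small-neighbourhood⇒feasible : ∀ {n} (G : Graph n) {C S : Subset n} →
  IsVertexCover G C → Independent G S → S ⊆ C → Nonempty S →
  ∣ N[_] G (∁ C) S ∣ ≤ 2 * ∣ S ∣ → Feasible G ∣ C ∣
small-neighbourhood⇒feasible G {C} {S} cover S-independent S⊆C S-nonempty ∣Y∣≤2∣S∣
  with ∣p∣≤a+b⇒split (N[_] G (∁ C) S) ∣ S ∣
         (≤-trans ∣Y∣≤2∣S∣ (≤-reflexive (cong (∣ S ∣ +_) (+-identityʳ ∣ S ∣))))
... | Y₁ , Y₁⊆Y , ∣Y₁∣≤∣S∣ , ∣Y─Y₁∣≤∣S∣ =
  tripPlan⇒feasible G (FerryPlan.plan G cover S-independent S⊆C S-nonempty Y₁⊆Y ∣Y₁∣≤∣S∣ ∣Y─Y₁∣≤∣S∣)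

corollary3p1 : ∀ {n : ℕ} (G : Graph n) → ClassTwo G →
    (C : Subset n) → IsMinVertexCover G C →
    (S : Subset n) → Nonempty S → Independent G S → S ⊆ C →
    2 * ∣ S ∣ < ∣ N[_] G (∁ C) S ∣
corollary3p1 G (c , k , (_ , _ , infeasible-below-c) , (D , (D-cover , _) , ∣D∣≡k) , c≡1+k)
             C (C-cover , C-minimum) S S-nonempty S-independent S⊆C
  with 2 * ∣ S ∣ <? ∣ N[_] G (∁ C) S ∣
... | yes large = large
... | no ¬large =
  contradiction (small-neighbourhood⇒feasible G C-cover S-independent S⊆C S-nonempty (≮⇒≥ ¬large))
                (infeasible-below-c ∣ C ∣ 1≤∣C∣ ∣C∣<c)
  where
  1≤∣C∣ : 1 ≤ ∣ C ∣
  1≤∣C∣ = ≤-trans (nonempty⇒1≤∣p∣ S-nonempty) (p⊆q⇒∣p∣≤∣q∣ S⊆C)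

  ∣C∣<c : ∣ C ∣ < c
  ∣C∣<c = subst (∣ C ∣ <_) (sym c≡1+k) (s≤s (subst (∣ C ∣ ≤_) ∣D∣≡k (C-minimum D D-cover)))
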